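{- For any pair of partitions $(\mu,\nu)$, if $(\lambda,\rho)=(\mu,\nu)^*$, then $\mu\cup\nu\succeq\lambda\cup\rho$ and $\mu+\nu\preceq\lambda+\rho$.
   Context: Partitions are weakly decreasing sequences of nonnegative integers, identified up to trailing zeros; $\mu'$ denotes the conjugate. For partitions $\mu,\nu$ written as $n$-tuples ($n\ge$ the number of nonzero parts of each), the $*$-operation is $(\mu,\nu)^*=(\lambda(\mu,\nu),\rho(\mu,\nu))$ with $\lambda_k=\mu_k-k+\#\{j\in\{1,\dots,n\}: \nu_j-j\ge \mu_k-k\}$ and $\rho_j=\nu_j-j+1+\#\{k\in\{1,\dots,n\}:\mu_k-k>\nu_j-j\}$; one has $|\lambda|+|\rho|=|\mu|+|\nu|$. $\mu+\nu$ is the partition with $(\mu+\nu)_i=\mu_i+\nu_i$, and $\mu\cup\nu:=(\mu'+\nu')'$ (the partition whose parts are those of $\mu$ and of $\nu$ together). For partitions $\alpha,\beta$ of the same integer, $\alpha\preceq\beta$ (dominance) means $\alpha_1+\dots+\alpha_k\le\beta_1+\dots+\beta_k$ for all $k\ge1$; $\beta\succeq\alpha$ means $\alpha\preceq\beta$. -}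

module Defs where

open import Data.Nat as ℕ using (ℕ; zero; suc)
open import Data.Integer as ℤ using (ℤ; +_; _+_; _-_)
open import Data.Fin as Fin using (Fin; toℕ)
open import Data.Vec as Vec using (Vec; lookup)
open import Data.List as List using (List; []; _∷_; filter; zipWith; take; _++_; foldr)
open import Data.List.Base using (allFin)
open import Data.Product using (_×_; _,_)
open import Relation.Binary.PropositionalEquality using (_≡_)
open import Relation.Nullary using (yes; no)

-- A partition written as an n-tuple: a weakly decreasing vector of naturals.
IsPartition : {n : ℕ} → Vec ℕ n → Set
IsPartition {n} v = (i j : Fin n) → i Fin.≤ j → lookup v j ℕ.≤ lookup v i

-- 1-based index of i : Fin n, as an integer.
idx : {n : ℕ} → Fin n → ℤ
idx i = + suc (toℕ i)

shifted : {n : ℕ} → Vec ℕ n → Fin n → ℤ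
shifted v k = + lookup v k - idx k

starλ : {n : ℕ} → Vec ℕ n → Vec ℕ n → Vec ℤ n
starλ {n} μ ν = Vec.tabulate λ k →
  shifted μ k + + List.length (filter (λ j → shifted μ k ℤ.≤? shifted ν j) (allFin n))

starρ : {n : ℕ} → Vec ℕ n → Vec ℕ n → Vec ℤ n
starρ {n} μ ν = Vec.tabulate λ j →
  shifted ν j + + 1 + + List.length (filter (λ k → shifted ν j ℤ.<? shifted μ k) (allFin n))

toℤs : {n : ℕ} → Vec ℕ n → List ℤ
toℤs v = List.map +_ (Vec.toList v)

insert : ℤ → List ℤ → List ℤ
insert x [] = x ∷ []
insert x (y ∷ ys) with y ℤ.≤? x
... | yes _ = x ∷ y ∷ ys
... | no  _ = y ∷ insert x ys

sortDesc : List ℤ → List ℤ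
sortDesc [] = []
sortDesc (x ∷ xs) = insert x (sortDesc xs)

_∪ₚ_ : List ℤ → List ℤ → List ℤ
α ∪ₚ β = sortDesc (α ++ β)

_+ₚ_ : List ℤ → List ℤ → List ℤ
α +ₚ β = zipWith _+_ α β

sumℤ : List ℤ → ℤ
sumℤ = foldr _+_ (+ 0)

-- sum of the first k parts (missing parts count as 0)
psum : ℕ → List ℤ → ℤ
psum k α = sumℤ (take k α)

_⪯_ : List ℤ → List ℤ → Set
α ⪯ β = (sumℤ α ≡ sumℤ β) × ((k : ℕ) → psum k α ℤ.≤ psum k β)

-- Write a_k = μ_k − k and b_j = ν_j − j; both sequences are strictly decreasing.
--
-- For μ + ν ⪯ λ + ρ: λ_k + ρ_k = μ_k + ν_k + c_k − (2k − 1), where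
-- c_k = #{j : a_k ≤ b_j} + #{j : b_k < a_j}. Among c_1, …, c_K every pair (i, j) with i, j ≤ K
-- is counted exactly once (as a_i ≤ b_j or as b_j < a_i), so c_1 + ⋯ + c_K ≥ K² = 1 + 3 + ⋯ + (2K − 1),
-- with equality for K = n.
--
-- For λ ∪ ρ ⪯ μ ∪ ν it suffices that every threshold sum Σ (x − t)⁺ over the parts is smaller for
-- λ ∪ ρ, which is shown by induction on n. If some b_j lies below a_n, let b_{j₀} be the first one:
-- deleting μ_n and ν_{j₀} deletes exactly λ_n and ρ_{j₀} from the *-operation, and ν_{j₀} ≤ λ_n ≤ μ_n
-- with λ_n + ρ_{j₀} = μ_n + ν_{j₀}, so by convexity of x ↦ (x − t)⁺ the deleted pair contributes less.
-- Otherwise a_n ≤ b_n, and symmetrically one deletes ν_n together with the first μ_{k₀} with a_{k₀} ≤ b_n.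

module Submission where

open import Defs
open import Data.Nat using (ℕ)
open import Data.Vec using (Vec; toList)
open import Data.Product using (_×_)

open import Data.Nat as ℕ using (zero; suc; s≤s; z≤n)
import Data.Nat.Properties as ℕP
open import Data.Nat.Tactic.RingSolver using () renaming (solve-∀ to ℕsolve)
open import Data.Integer as ℤ using (ℤ; +_; _+_; _-_; _≤_; _≥_; _<_; _⊔_; +≤+)
import Data.Integer.Properties as ℤP
open import Data.Integer.Tactic.RingSolver using (solve-∀)
open import Data.Fin using (Fin; toℕ; punchIn; fromℕ; fromℕ<) renaming (zero to fz; suc to fs)
import Data.Fin.Properties as FinP
open import Data.Vec as Vec using (lookup)
import Data.Vec.Properties as VP
open import Data.Vec.Functional using (Vector; removeAt)
open import Data.List as List using (List; []; _∷_; _++_; length)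
import Data.List.Properties as LP
open import Data.List.Membership.Propositional using (_∈_)
open import Data.List.Relation.Unary.Any using (here; there)
open import Data.List.Relation.Unary.All as All using (All; []; _∷_)
open import Data.List.Relation.Unary.AllPairs using (AllPairs; []; _∷_)
open import Data.List.Relation.Binary.Permutation.Propositional
  using (_↭_; ↭-refl; ↭-prep; ↭-swap; ↭-trans; ↭-sym; ↭⇒↭ₛ)
open import Data.List.Relation.Binary.Permutation.Propositional.Properties using (All-resp-↭; ↭-length; map⁺)
open import Data.List.Relation.Binary.Permutation.Setoid.Properties using (foldr-commMonoid)
open import Data.Product using (_,_; proj₁; ∃-syntax)
open import Data.Sum using (inj₁; inj₂)
open import Data.Empty using (⊥-elim)
open import Function using (_∘_; id; _⇔_; mk⇔; Equivalence)
open import Relation.Nullary using (Dec; yes; no; ¬_)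
open import Relation.Binary.PropositionalEquality

open import Algebra.Properties.CommutativeMonoid.Sum ℤP.+-0-commutativeMonoid
  using (sum; sum-remove; sum-cong-≗; ∑-distrib-+)
import Algebra.Properties.CommutativeMonoid.Sum ℕP.+-0-commutativeMonoid as ℕΣ
open import Algebra.Definitions.RawMonoid ℤ.+-0-rawMonoid using () renaming (_×_ to _·_)
open import Algebra.Properties.CommutativeSemigroup ℤP.+-commutativeSemigroup
  using () renaming (interchange to +-interchange)
open import Algebra.Properties.CommutativeSemigroup ℕP.+-commutativeSemigroup
  using () renaming (interchange to ℕ+-interchange)

𝟙 : ∀ {P : Set} → Dec P → ℕ
𝟙 (yes _) = 1
𝟙 (no _) = 0

𝟙-yes : ∀ {P : Set} (P? : Dec P) → P → 𝟙 P? ≡ 1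
𝟙-yes (yes _) _ = refl
𝟙-yes (no ¬p) p = ⊥-elim (¬p p)

𝟙-no : ∀ {P : Set} (P? : Dec P) → ¬ P → 𝟙 P? ≡ 0
𝟙-no (yes p) ¬p = ⊥-elim (¬p p)
𝟙-no (no _) _ = refl

𝟙-cong : ∀ {P Q : Set} (P? : Dec P) (Q? : Dec Q) → P ⇔ Q → 𝟙 P? ≡ 𝟙 Q?
𝟙-cong (yes _) (yes _) _ = refl
𝟙-cong (yes p) (no ¬q) P⇔Q = ⊥-elim (¬q (Equivalence.to P⇔Q p))
𝟙-cong (no ¬p) (yes q) P⇔Q = ⊥-elim (¬p (Equivalence.from P⇔Q q))
𝟙-cong (no _) (no _) _ = refl

⇔-≡ : ∀ {A B : Set} (R : A → B → Set) {x x' y y'} → x ≡ x' → y ≡ y' → R x y ⇔ R x' y'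
⇔-≡ R refl refl = mk⇔ id id

⇔-¬ : ∀ {A B : Set} → ¬ A → ¬ B → A ⇔ B
⇔-¬ ¬a ¬b = mk⇔ (⊥-elim ∘ ¬a) (⊥-elim ∘ ¬b)

count : ∀ {n} {P : Fin n → Set} → (∀ i → Dec (P i)) → ℕ
count P? = ℕΣ.sum (λ i → 𝟙 (P? i))

count-remove : ∀ {n} {P : Fin (suc n) → Set} (P? : ∀ i → Dec (P i)) (p : Fin (suc n)) →
  count P? ≡ 𝟙 (P? p) ℕ.+ count (P? ∘ punchIn p)
count-remove P? p = ℕΣ.sum-remove (λ i → 𝟙 (P? i))

count-cong : ∀ {n} {P Q : Fin n → Set} (P? : ∀ i → Dec (P i)) (Q? : ∀ i → Dec (Q i)) →
  (∀ i → P i ⇔ Q i) → count P? ≡ count Q?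
count-cong P? Q? P⇔Q = ℕΣ.sum-cong-≗ (λ i → 𝟙-cong (P? i) (Q? i) (P⇔Q i))

count-all : ∀ {n} {P : Fin n → Set} (P? : ∀ i → Dec (P i)) → (∀ i → P i) → count P? ≡ n
count-all {zero} P? _ = refl
count-all {suc n} P? p = cong₂ ℕ._+_ (𝟙-yes (P? fz) (p fz)) (count-all (P? ∘ fs) (p ∘ fs))

count-none : ∀ {n} {P : Fin n → Set} (P? : ∀ i → Dec (P i)) → (∀ i → ¬ P i) → count P? ≡ 0
count-none {zero} P? _ = refl
count-none {suc n} P? ¬p = cong₂ ℕ._+_ (𝟙-no (P? fz) (¬p fz)) (count-none (P? ∘ fs) (¬p ∘ fs))

count-punchIn : ∀ {n} {P : Fin (suc n) → Set} {Q : Fin n → Set}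
  (P? : ∀ i → Dec (P i)) (Q? : ∀ i → Dec (Q i)) (p : Fin (suc n)) →
  ¬ P p → (∀ i → Q i ⇔ P (punchIn p i)) → count Q? ≡ count P?
count-punchIn P? Q? p ¬Pp Q⇔P = begin
  count Q?                                  ≡⟨ count-cong Q? (P? ∘ punchIn p) Q⇔P ⟩
  count (P? ∘ punchIn p)                    ≡⟨ cong (ℕ._+ count (P? ∘ punchIn p)) (𝟙-no (P? p) ¬Pp) ⟨
  𝟙 (P? p) ℕ.+ count (P? ∘ punchIn p)       ≡⟨ count-remove P? p ⟨
  count P?                                  ∎
  where open ≡-Reasoning

DownwardClosed : ∀ {n} → (Fin n → Set) → Set
DownwardClosed P = ∀ i i' → toℕ i ℕ.≤ toℕ i' → P i' → P i

count-initialSegment : ∀ {n} {P : Fin n → Set} (P? : ∀ i → Dec (P i)) → DownwardClosed P →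
  ∀ i → P i ⇔ toℕ i ℕ.< count P?
count-initialSegment {suc n} P? closed i with P? fz
... | no ¬p₀ = mk⇔ (λ p → ⊥-elim (¬p₀ (closed fz i z≤n p)))
                   (λ i<c → ⊥-elim (ℕP.n≮0 (subst (toℕ i ℕ.<_) none i<c)))
  where none = count-none (P? ∘ fs) (λ i' p → ¬p₀ (closed fz (fs i') z≤n p))
count-initialSegment {suc n} P? closed fz | yes p₀ = mk⇔ (λ _ → s≤s z≤n) (λ _ → p₀)
count-initialSegment {suc n} P? closed (fs i) | yes _ =
  mk⇔ (s≤s ∘ Equivalence.to tail) (Equivalence.from tail ∘ ℕ.s≤s⁻¹)
  where tail = count-initialSegment (P? ∘ fs) (λ a b → closed (fs a) (fs b) ∘ s≤s) i

𝟙-≤-< : ∀ x y → 𝟙 (x ℤ.≤? y) ℕ.+ 𝟙 (y ℤ.<? x) ≡ 1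
𝟙-≤-< x y with x ℤ.≤? y
... | yes x≤y = cong suc (𝟙-no (y ℤ.<? x) (ℤP.≤⇒≯ x≤y))
... | no x≰y = 𝟙-yes (y ℤ.<? x) (ℤP.≰⇒> x≰y)


-- The excess function x ↦ (x − t)⁺

≤-rebalance : ∀ {a b x y : ℤ} → a ≤ b → x + b ≡ y + a → x ≤ y
≤-rebalance {a} {b} {x} {y} a≤b eq = begin
  x         ≡⟨ cancel x b ⟨
  x + b - b ≡⟨ cong (_- b) eq ⟩
  y + a - b ≤⟨ ℤP.+-monoˡ-≤ (ℤ.- b) (ℤP.+-monoʳ-≤ y a≤b) ⟩
  y + b - b ≡⟨ cancel y b ⟩
  y         ∎
  where
  open ℤP.≤-Reasoning
  cancel : ∀ x b → x + b - b ≡ x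
  cancel = solve-∀

excess : ℤ → ℤ → ℤ
excess t x = (x - t) ⊔ + 0

excess-nonneg : ∀ t x → + 0 ≤ excess t x
excess-nonneg t x = ℤP.i≤j⊔i (x - t) (+ 0)

excess-below : ∀ {t x} → x ≤ t → excess t x ≡ + 0
excess-below x≤t = ℤP.i≤j⇒i⊔j≡j (ℤP.i≤j⇒i-j≤0 x≤t)

excess-above : ∀ {t x} → t ≤ x → excess t x ≡ x - t
excess-above t≤x = ℤP.i≥j⇒i⊔j≡i (ℤP.i≤j⇒0≤j-i t≤x)

excess-mono : ∀ t {x y} → x ≤ y → excess t x ≤ excess t y
excess-mono t x≤y = ℤP.⊔-monoˡ-≤ (+ 0) (ℤP.+-monoˡ-≤ (ℤ.- t) x≤y)

excess-lipschitz : ∀ t {x y} → x ≤ y → excess t y ≤ excess t x + (y - x)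
excess-lipschitz t {x} {y} x≤y = ℤP.⊔-lub
  (ℤP.≤-trans (ℤP.≤-reflexive (split y x t)) (ℤP.+-monoˡ-≤ (y - x) (ℤP.i≤i⊔j (x - t) (+ 0))))
  (ℤP.+-mono-≤ (excess-nonneg t x) (ℤP.i≤j⇒0≤j-i x≤y))
  where
  split : ∀ y x t → y - t ≡ (x - t) + (y - x)
  split = solve-∀

-- Convexity of x ↦ (x − t)⁺.
excess-transfer : ∀ t {x y x' y'} → x' + y' ≡ x + y → y ≤ x' → x' ≤ x →
  excess t x' + excess t y' ≤ excess t x + excess t y
excess-transfer t {x} {y} {x'} {y'} sum≡ y≤x' x'≤x with ℤP.≤-total t x'
... | inj₁ t≤x' = begin
  excess t x' + excess t y'         ≡⟨ cong (λ e → e + excess t y') (excess-above t≤x') ⟩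
  (x' - t) + excess t y'            ≤⟨ ℤP.+-monoʳ-≤ (x' - t) (excess-lipschitz t y≤y') ⟩
  (x' - t) + (excess t y + (y' - y)) ≡⟨ regroup x' y' t (excess t y) y ⟩
  (x' + y') - y - t + excess t y    ≡⟨ cong (λ s → s - y - t + excess t y) sum≡ ⟩
  (x + y) - y - t + excess t y      ≡⟨ cancel x y t (excess t y) ⟩
  (x - t) + excess t y              ≡⟨ cong (λ e → e + excess t y) (excess-above (ℤP.≤-trans t≤x' x'≤x)) ⟨
  excess t x + excess t y           ∎
  where
  open ℤP.≤-Reasoning
  y≤y' : y ≤ y'
  y≤y' = ≤-rebalance x'≤x (trans (ℤP.+-comm y x) (trans (sym sum≡) (ℤP.+-comm x' y')))
  regroup : ∀ x' y' t e y → (x' - t) + (e + (y' - y)) ≡ (x' + y') - y - t + e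
  regroup = solve-∀
  cancel : ∀ x y t e → (x + y) - y - t + e ≡ (x - t) + e
  cancel = solve-∀
... | inj₂ x'≤t = begin
  excess t x' + excess t y'  ≡⟨ cong (λ e → e + excess t y') (excess-below x'≤t) ⟩
  + 0 + excess t y'          ≡⟨ ℤP.+-identityˡ (excess t y') ⟩
  excess t y'                ≤⟨ excess-mono t y'≤x ⟩
  excess t x                 ≡⟨ ℤP.+-identityʳ (excess t x) ⟨
  excess t x + + 0           ≡⟨ cong (λ e → excess t x + e) (excess-below (ℤP.≤-trans y≤x' x'≤t)) ⟨
  excess t x + excess t y    ∎
  where
  open ℤP.≤-Reasoning
  y'≤x : y' ≤ x
  y'≤x = ≤-rebalance y≤x' (trans (ℤP.+-comm y' x') sum≡)


toℕ-punchIn-< : ∀ {n} (p : Fin (suc n)) (i : Fin n) → toℕ i ℕ.< toℕ p →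
  toℕ (punchIn p i) ≡ toℕ i
toℕ-punchIn-< (fs p) fz _ = refl
toℕ-punchIn-< (fs p) (fs i) (s≤s i<p) = cong suc (toℕ-punchIn-< p i i<p)

toℕ-punchIn-≥ : ∀ {n} (p : Fin (suc n)) (i : Fin n) → toℕ p ℕ.≤ toℕ i →
  toℕ (punchIn p i) ≡ suc (toℕ i)
toℕ-punchIn-≥ fz i _ = refl
toℕ-punchIn-≥ (fs p) (fs i) (s≤s p≤i) = cong suc (toℕ-punchIn-≥ p i p≤i)

toℕ<toℕ-fromℕ : ∀ {m} (i : Fin m) → toℕ i ℕ.< toℕ (fromℕ m)
toℕ<toℕ-fromℕ {m} i = subst (toℕ i ℕ.<_) (sym (FinP.toℕ-fromℕ m)) (FinP.toℕ<n i)

Decreasing : ∀ {n} → Vector ℤ n → Set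
Decreasing M = ∀ {i i'} → toℕ i ℕ.≤ toℕ i' → M i' ≤ M i

Decreasing-removeAt : ∀ {n} {M : Vector ℤ (suc n)} (p : Fin (suc n)) →
  Decreasing M → Decreasing (removeAt M p)
Decreasing-removeAt {M = M} p dec {i} {i'} i≤i' = dec (FinP.punchIn-mono-≤ p i i' i≤i')

-- The paper's μ_k − k, with the 1-based index k = toℕ k + 1.
shift : ∀ {n} → Vector ℤ n → Vector ℤ n
shift M k = M k - + suc (toℕ k)

shift-anti-≤ : ∀ {n} {M : Vector ℤ n} → Decreasing M →
  ∀ {i i'} → toℕ i ℕ.≤ toℕ i' → shift M i' ≤ shift M i
shift-anti-≤ dec i≤i' = ℤP.+-mono-≤ (dec i≤i') (ℤP.neg-mono-≤ (+≤+ (s≤s i≤i')))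

shift-anti-< : ∀ {n} {M : Vector ℤ n} → Decreasing M →
  ∀ {i i'} → toℕ i ℕ.< toℕ i' → shift M i' < shift M i
shift-anti-< dec i<i' = ℤP.+-mono-≤-< (dec (ℕP.<⇒≤ i<i')) (ℤP.neg-mono-< (ℤ.+<+ (s≤s i<i')))

shift-removeAt-< : ∀ {n} (M : Vector ℤ (suc n)) (p : Fin (suc n)) (i : Fin n) → toℕ i ℕ.< toℕ p →
  shift (removeAt M p) i ≡ shift M (punchIn p i)
shift-removeAt-< M p i i<p = cong (λ k → M (punchIn p i) - + suc k) (sym (toℕ-punchIn-< p i i<p))

shift-removeAt-≥ : ∀ {n} (M : Vector ℤ (suc n)) (p : Fin (suc n)) (i : Fin n) → toℕ p ℕ.≤ toℕ i →
  shift (removeAt M p) i ≡ ℤ.suc (shift M (punchIn p i))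
shift-removeAt-≥ M p i p≤i = begin
  x - + suc (toℕ i)                   ≡⟨ unshift x (+ suc (toℕ i)) ⟨
  + 1 + (x - (+ 1 + + suc (toℕ i)))   ≡⟨ cong (λ k → + 1 + (x - + suc k)) (toℕ-punchIn-≥ p i p≤i) ⟨
  ℤ.suc (shift M (punchIn p i))       ∎
  where
  open ≡-Reasoning
  x = M (punchIn p i)
  unshift : ∀ x k → + 1 + (x - (+ 1 + k)) ≡ x - k
  unshift = solve-∀

shift-<-shift-removeAt : ∀ {n} (M : Vector ℤ (suc n)) (p : Fin (suc n)) (i : Fin n) →
  toℕ p ℕ.≤ toℕ i → shift M (punchIn p i) < shift (removeAt M p) i
shift-<-shift-removeAt M p i p≤i =
  subst (shift M (punchIn p i) <_) (sym (shift-removeAt-≥ M p i p≤i)) (ℤP.suc[i]≤j⇒i<j ℤP.≤-refl)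

shift-removeAt-≤-shift : ∀ {n} {M : Vector ℤ (suc n)} → Decreasing M →
  ∀ p i → toℕ p ℕ.≤ toℕ i → shift (removeAt M p) i ≤ shift M p
shift-removeAt-≤-shift {M = M} dec p i p≤i = subst (_≤ shift M p) (sym (shift-removeAt-≥ M p i p≤i))
  (ℤP.i<j⇒suc[i]≤j (shift-anti-< dec p<p[i]))
  where
  p<p[i] : toℕ p ℕ.< toℕ (punchIn p i)
  p<p[i] = subst (toℕ p ℕ.<_) (sym (toℕ-punchIn-≥ p i p≤i)) (s≤s p≤i)

shift-last-≤ : ∀ {m} {M : Vector ℤ (suc m)} → Decreasing M → ∀ k → shift M (fromℕ m) ≤ shift M k
shift-last-≤ {m} dec k =
  shift-anti-≤ dec (subst (toℕ k ℕ.≤_) (sym (FinP.toℕ-fromℕ m)) (FinP.toℕ≤pred[n] k))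

≤shift⇔<count : ∀ {n} {N : Vector ℤ n} → Decreasing N → ∀ x j →
  x ≤ shift N j ⇔ toℕ j ℕ.< count (λ j → x ℤ.≤? shift N j)
≤shift⇔<count {N = N} dec x = count-initialSegment (λ j → x ℤ.≤? shift N j)
  (λ _ _ j≤j' x≤ → ℤP.≤-trans x≤ (shift-anti-≤ dec j≤j'))

<shift⇔<count : ∀ {n} {M : Vector ℤ n} → Decreasing M → ∀ x k →
  x < shift M k ⇔ toℕ k ℕ.< count (λ k → x ℤ.<? shift M k)
<shift⇔<count {M = M} dec x = count-initialSegment (λ k → x ℤ.<? shift M k)
  (λ _ _ k≤k' x< → ℤP.<-≤-trans x< (shift-anti-≤ dec k≤k'))

lam* : ∀ {n} → Vector ℤ n → Vector ℤ n → Vector ℤ n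
lam* M N k = shift M k + + count (λ j → shift M k ℤ.≤? shift N j)

rho* : ∀ {n} → Vector ℤ n → Vector ℤ n → Vector ℤ n
rho* M N j = shift N j + + 1 + + count (λ k → shift N j ℤ.<? shift M k)

crossCount : ∀ {n} → Vector ℤ n → Vector ℤ n → Vector ℕ n
crossCount a b i = count (λ j → a i ℤ.≤? b j) ℕ.+ count (λ k → b i ℤ.<? a k)

-- 2k − 1 in the paper's 1-based indexing.
odd : ∀ {n} → Vector ℕ n
odd i = toℕ i ℕ.+ toℕ i ℕ.+ 1

lam*+rho* : ∀ {n} (M N : Vector ℤ n) i →
  lam* M N i + rho* M N i ≡ (M i + N i) + (+ crossCount (shift M) (shift N) i - + odd i)
lam*+rho* M N i = regroup (M i) (N i) (+ toℕ i)
  (+ count (λ j → shift M i ℤ.≤? shift N j)) (+ count (λ k → shift N i ℤ.<? shift M k))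
  where
  regroup : ∀ x y t α β →
    (x - (+ 1 + t) + α) + (y - (+ 1 + t) + + 1 + β) ≡ (x + y) + ((α + β) - (t + t + + 1))
  regroup = solve-∀


-- Threshold sums of λ ∪ ρ

excessSum : ∀ {n} → ℤ → Vector ℤ n → ℤ
excessSum t g = sum (λ i → excess t (g i))

excessSum-removeAt : ∀ t {m} (g : Vector ℤ (suc m)) (p : Fin (suc m)) {h : Vector ℤ m} →
  (∀ i → h i ≡ g (punchIn p i)) → excessSum t g ≡ excess t (g p) + excessSum t h
excessSum-removeAt t g p h≗ = trans (sum-remove (excess t ∘ g))
  (cong (λ s → excess t (g p) + s) (sum-cong-≗ (cong (excess t) ∘ sym ∘ h≗)))

StarExcess≤ : ∀ {n} → ℤ → Vector ℤ n → Vector ℤ n → Set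
StarExcess≤ t M N = excessSum t (lam* M N) + excessSum t (rho* M N) ≤ excessSum t M + excessSum t N

starExcess-removeAt : ∀ t {m} (M N : Vector ℤ (suc m)) (p q : Fin (suc m)) →
  (∀ i → lam* (removeAt M p) (removeAt N q) i ≡ lam* M N (punchIn p i)) →
  (∀ j → rho* (removeAt M p) (removeAt N q) j ≡ rho* M N (punchIn q j)) →
  excess t (lam* M N p) + excess t (rho* M N q) ≤ excess t (M p) + excess t (N q) →
  StarExcess≤ t (removeAt M p) (removeAt N q) → StarExcess≤ t M N
starExcess-removeAt t M N p q lam-eq rho-eq pair IH = begin
  excessSum t (lam* M N) + excessSum t (rho* M N)
    ≡⟨ cong₂ _+_ (excessSum-removeAt t (lam* M N) p lam-eq) (excessSum-removeAt t (rho* M N) q rho-eq) ⟩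
  (excess t (lam* M N p) + excessSum t (lam* M' N')) + (excess t (rho* M N q) + excessSum t (rho* M' N'))
    ≡⟨ +-interchange (excess t (lam* M N p)) _ (excess t (rho* M N q)) _ ⟩
  (excess t (lam* M N p) + excess t (rho* M N q)) + (excessSum t (lam* M' N') + excessSum t (rho* M' N'))
    ≤⟨ ℤP.+-mono-≤ pair IH ⟩
  (excess t (M p) + excess t (N q)) + (excessSum t M' + excessSum t N')
    ≡⟨ +-interchange (excess t (M p)) (excess t (N q)) (excessSum t M') (excessSum t N') ⟩
  (excess t (M p) + excessSum t M') + (excess t (N q) + excessSum t N')
    ≡⟨ cong₂ _+_ (excessSum-removeAt t M p (λ _ → refl)) (excessSum-removeAt t N q (λ _ → refl)) ⟨
  excessSum t M + excessSum t N ∎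
  where
  open ℤP.≤-Reasoning
  M' = removeAt M p
  N' = removeAt N q

-- With a = shift M and b = shift N: the case where some b_j lies below a_L for the last index L, and
-- b_{j₀} is the first such part. Removing M_L and N_{j₀} removes exactly λ_L and ρ_{j₀}.
module RemoveLastOfM {m} {M N : Vector ℤ (suc m)} (decM : Decreasing M) (decN : Decreasing N)
  (j₀<n : count (λ j → shift M (fromℕ m) ℤ.≤? shift N j) ℕ.< suc m) where

  L j₀ : Fin (suc m)
  L = fromℕ m
  j₀ = fromℕ< j₀<n

  M' N' : Vector ℤ m
  M' = removeAt M L
  N' = removeAt N j₀

  private
    a b : Vector ℤ (suc m)
    a = shift M
    b = shift N
    a' b' : Vector ℤ m
    a' = shift M'
    b' = shift N'

    aL≤b⇔ : ∀ j → a L ≤ b j ⇔ toℕ j ℕ.< toℕ j₀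
    aL≤b⇔ j = subst (λ c → a L ≤ b j ⇔ toℕ j ℕ.< c) (sym (FinP.toℕ-fromℕ< j₀<n))
      (≤shift⇔<count decN (a L) j)

    bj₀<a : ∀ k → b j₀ < a k
    bj₀<a k = ℤP.<-≤-trans (ℤP.≰⇒> (ℕP.<-irrefl refl ∘ Equivalence.to (aL≤b⇔ j₀)))
      (shift-last-≤ decM k)

    a'≡ : ∀ i → a' i ≡ a (punchIn L i)
    a'≡ i = shift-removeAt-< M L i (toℕ<toℕ-fromℕ i)

    late< : ∀ j' → toℕ j₀ ℕ.≤ toℕ j' → ∀ k → b' j' < a k
    late< j' j₀≤j' k = ℤP.≤-<-trans (shift-removeAt-≤-shift decN j₀ j' j₀≤j') (bj₀<a k)

    early≥ : ∀ j' → toℕ j' ℕ.< toℕ j₀ → a L ≤ b (punchIn j₀ j')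
    early≥ j' j'<j₀ = Equivalence.from (aL≤b⇔ (punchIn j₀ j'))
      (subst (ℕ._< toℕ j₀) (sym (toℕ-punchIn-< j₀ j' j'<j₀)) j'<j₀)

  lam*-removeAt : ∀ i → lam* M' N' i ≡ lam* M N (punchIn L i)
  lam*-removeAt i = cong₂ (λ s c → s + + c) (a'≡ i)
    (count-punchIn (λ j → a (punchIn L i) ℤ.≤? b j) (λ j' → a' i ℤ.≤? b' j') j₀
      (ℤP.<⇒≱ (bj₀<a (punchIn L i))) same)
    where
    same : ∀ j' → a' i ≤ b' j' ⇔ a (punchIn L i) ≤ b (punchIn j₀ j')
    same j' with toℕ j' ℕ.<? toℕ j₀
    ... | yes j'<j₀ = ⇔-≡ _≤_ (a'≡ i) (shift-removeAt-< N j₀ j' j'<j₀)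
    ... | no j'≮j₀ = ⇔-¬ (ℤP.<⇒≱ (subst (b' j' <_) (sym (a'≡ i)) b'<a))
                         (ℤP.<⇒≱ (ℤP.<-trans (shift-<-shift-removeAt N j₀ j' j₀≤j') b'<a))
      where
      j₀≤j' = ℕP.≮⇒≥ j'≮j₀
      b'<a = late< j' j₀≤j' (punchIn L i)

  rho*-removeAt : ∀ j' → rho* M' N' j' ≡ rho* M N (punchIn j₀ j')
  rho*-removeAt j' with toℕ j' ℕ.<? toℕ j₀
  ... | yes j'<j₀ = cong₂ (λ s c → s + + 1 + + c) (shift-removeAt-< N j₀ j' j'<j₀)
    (count-punchIn (λ k → b (punchIn j₀ j') ℤ.<? a k) (λ i → b' j' ℤ.<? a' i) L
      (ℤP.≤⇒≯ (early≥ j' j'<j₀)) (λ i → ⇔-≡ _<_ (shift-removeAt-< N j₀ j' j'<j₀) (a'≡ i)))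
  ... | no j'≮j₀ = begin
    b' j' + + 1 + + count (λ i → b' j' ℤ.<? a' i)
      ≡⟨ cong₂ (λ s c → s + + 1 + + c) (shift-removeAt-≥ N j₀ j' j₀≤j')
           (count-all (λ i → b' j' ℤ.<? a' i)
             (λ i → subst (b' j' <_) (sym (a'≡ i)) (late< j' j₀≤j' (punchIn L i)))) ⟩
    ℤ.suc u + + 1 + + m       ≡⟨ regroup u (+ m) ⟩
    u + + 1 + + suc m         ≡⟨ cong (λ c → u + + 1 + + c) (count-all (λ k → u ℤ.<? a k) u<a) ⟨
    rho* M N (punchIn j₀ j') ∎
    where
    open ≡-Reasoning
    j₀≤j' = ℕP.≮⇒≥ j'≮j₀
    u = b (punchIn j₀ j')
    u<a : ∀ k → u < a k
    u<a k = ℤP.<-trans (shift-<-shift-removeAt N j₀ j' j₀≤j') (late< j' j₀≤j' k)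
    regroup : ∀ u m → + 1 + u + + 1 + m ≡ u + + 1 + (+ 1 + m)
    regroup = solve-∀

  excess-pair : ∀ t → excess t (lam* M N L) + excess t (rho* M N j₀) ≤ excess t (M L) + excess t (N j₀)
  excess-pair t = excess-transfer t sum≡ N≤lam lam≤M
    where
    lam-L : lam* M N L ≡ a L + + toℕ j₀
    lam-L = cong (λ c → a L + + c) (sym (FinP.toℕ-fromℕ< j₀<n))
    aL≡ : a L ≡ M L - + suc m
    aL≡ = cong (λ k → M L - + suc k) (FinP.toℕ-fromℕ m)
    lam-L′ : lam* M N L ≡ M L - + suc m + + toℕ j₀
    lam-L′ = trans lam-L (cong (λ x → x + + toℕ j₀) aL≡)
    rho-j₀ : rho* M N j₀ ≡ b j₀ + + 1 + + suc m
    rho-j₀ = cong (λ c → b j₀ + + 1 + + c) (count-all (λ k → b j₀ ℤ.<? a k) bj₀<a)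
    sum≡ : lam* M N L + rho* M N j₀ ≡ M L + N j₀
    sum≡ = trans (cong₂ _+_ lam-L′ rho-j₀) (cancel (M L) (N j₀) (+ m) (+ toℕ j₀))
      where
      cancel : ∀ x y m j → (x - (+ 1 + m) + j) + (y - (+ 1 + j) + + 1 + (+ 1 + m)) ≡ x + y
      cancel = solve-∀
    lam≤M : lam* M N L ≤ M L
    lam≤M = ≤-rebalance (+≤+ (ℕP.<⇒≤ (FinP.toℕ<n j₀)))
      (trans (cong (λ l → l + + suc m) lam-L′) (rebalance (M L) (+ m) (+ toℕ j₀)))
      where
      rebalance : ∀ x m j → x - (+ 1 + m) + j + (+ 1 + m) ≡ x + j
      rebalance = solve-∀
    N≤lam : N j₀ ≤ lam* M N L
    N≤lam = subst (N j₀ ≤_) (sym lam-L)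
      (≤-rebalance (ℤP.i<j⇒suc[i]≤j (bj₀<a L)) (rebalance (N j₀) (a L) (+ toℕ j₀)))
      where
      rebalance : ∀ y a j → y + a ≡ a + j + (+ 1 + (y - (+ 1 + j)))
      rebalance = solve-∀

-- The case where some a_k lies at or below b_L, and a_{k₀} is the first such part.
-- Removing M_{k₀} and N_L removes exactly λ_{k₀} and ρ_L.
module RemoveLastOfN {m} {M N : Vector ℤ (suc m)} (decM : Decreasing M) (decN : Decreasing N)
  (k₀<n : count (λ k → shift N (fromℕ m) ℤ.<? shift M k) ℕ.< suc m) where

  L k₀ : Fin (suc m)
  L = fromℕ m
  k₀ = fromℕ< k₀<n

  M' N' : Vector ℤ m
  M' = removeAt M k₀
  N' = removeAt N L

  private
    a b : Vector ℤ (suc m)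
    a = shift M
    b = shift N
    a' b' : Vector ℤ m
    a' = shift M'
    b' = shift N'

    bL<a⇔ : ∀ k → b L < a k ⇔ toℕ k ℕ.< toℕ k₀
    bL<a⇔ k = subst (λ c → b L < a k ⇔ toℕ k ℕ.< c) (sym (FinP.toℕ-fromℕ< k₀<n))
      (<shift⇔<count decM (b L) k)

    ak₀≤b : ∀ j → a k₀ ≤ b j
    ak₀≤b j = ℤP.≤-trans (ℤP.≮⇒≥ (ℕP.<-irrefl refl ∘ Equivalence.to (bL<a⇔ k₀)))
      (shift-last-≤ decN j)

    b'≡ : ∀ j' → b' j' ≡ b (punchIn L j')
    b'≡ j' = shift-removeAt-< N L j' (toℕ<toℕ-fromℕ j')

    late≤ : ∀ i → toℕ k₀ ℕ.≤ toℕ i → ∀ j → a' i ≤ b j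
    late≤ i k₀≤i j = ℤP.≤-trans (shift-removeAt-≤-shift decM k₀ i k₀≤i) (ak₀≤b j)

    early> : ∀ i → toℕ i ℕ.< toℕ k₀ → b L < a (punchIn k₀ i)
    early> i i<k₀ = Equivalence.from (bL<a⇔ (punchIn k₀ i))
      (subst (ℕ._< toℕ k₀) (sym (toℕ-punchIn-< k₀ i i<k₀)) i<k₀)

  lam*-removeAt : ∀ i → lam* M' N' i ≡ lam* M N (punchIn k₀ i)
  lam*-removeAt i with toℕ i ℕ.<? toℕ k₀
  ... | yes i<k₀ = cong₂ (λ s c → s + + c) (shift-removeAt-< M k₀ i i<k₀)
    (count-punchIn (λ j → a (punchIn k₀ i) ℤ.≤? b j) (λ j' → a' i ℤ.≤? b' j') L
      (ℤP.<⇒≱ (early> i i<k₀)) (λ j' → ⇔-≡ _≤_ (shift-removeAt-< M k₀ i i<k₀) (b'≡ j')))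
  ... | no i≮k₀ = begin
    a' i + + count (λ j' → a' i ℤ.≤? b' j')
      ≡⟨ cong₂ (λ s c → s + + c) (shift-removeAt-≥ M k₀ i k₀≤i)
           (count-all (λ j' → a' i ℤ.≤? b' j')
             (λ j' → subst (a' i ≤_) (sym (b'≡ j')) (late≤ i k₀≤i (punchIn L j')))) ⟩
    ℤ.suc s + + m      ≡⟨ regroup s (+ m) ⟩
    s + + suc m        ≡⟨ cong (λ c → s + + c) (count-all (λ j → s ℤ.≤? b j) s≤b) ⟨
    lam* M N (punchIn k₀ i) ∎
    where
    open ≡-Reasoning
    k₀≤i = ℕP.≮⇒≥ i≮k₀
    s = a (punchIn k₀ i)
    s≤b : ∀ j → s ≤ b j
    s≤b j = ℤP.≤-trans (ℤP.<⇒≤ (shift-<-shift-removeAt M k₀ i k₀≤i)) (late≤ i k₀≤i j)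
    regroup : ∀ s m → + 1 + s + m ≡ s + (+ 1 + m)
    regroup = solve-∀

  rho*-removeAt : ∀ j' → rho* M' N' j' ≡ rho* M N (punchIn L j')
  rho*-removeAt j' = cong₂ (λ s c → s + + 1 + + c) (b'≡ j')
    (count-punchIn (λ k → b (punchIn L j') ℤ.<? a k) (λ i → b' j' ℤ.<? a' i) k₀
      (ℤP.≤⇒≯ (ak₀≤b (punchIn L j'))) same)
    where
    same : ∀ i → b' j' < a' i ⇔ b (punchIn L j') < a (punchIn k₀ i)
    same i with toℕ i ℕ.<? toℕ k₀
    ... | yes i<k₀ = ⇔-≡ _<_ (b'≡ j') (shift-removeAt-< M k₀ i i<k₀)
    ... | no i≮k₀ = ⇔-¬ (ℤP.≤⇒≯ (subst (a' i ≤_) (sym (b'≡ j')) a'≤b))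
                        (ℤP.≤⇒≯ (ℤP.≤-trans (ℤP.<⇒≤ (shift-<-shift-removeAt M k₀ i k₀≤i)) a'≤b))
      where
      k₀≤i = ℕP.≮⇒≥ i≮k₀
      a'≤b = late≤ i k₀≤i (punchIn L j')

  excess-pair : ∀ t → excess t (lam* M N k₀) + excess t (rho* M N L) ≤ excess t (M k₀) + excess t (N L)
  excess-pair t = subst₂ _≤_ (ℤP.+-comm (excess t (rho* M N L)) _) (ℤP.+-comm (excess t (N L)) _)
    (excess-transfer t sum≡ M≤rho rho≤N)
    where
    rho-L : rho* M N L ≡ b L + + 1 + + toℕ k₀
    rho-L = cong (λ c → b L + + 1 + + c) (sym (FinP.toℕ-fromℕ< k₀<n))
    bL≡ : b L ≡ N L - + suc m
    bL≡ = cong (λ k → N L - + suc k) (FinP.toℕ-fromℕ m)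
    rho-L′ : rho* M N L ≡ N L - + suc m + + 1 + + toℕ k₀
    rho-L′ = trans rho-L (cong (λ y → y + + 1 + + toℕ k₀) bL≡)
    lam-k₀ : lam* M N k₀ ≡ a k₀ + + suc m
    lam-k₀ = cong (λ c → a k₀ + + c) (count-all (λ j → a k₀ ℤ.≤? b j) ak₀≤b)
    sum≡ : rho* M N L + lam* M N k₀ ≡ N L + M k₀
    sum≡ = trans (cong₂ _+_ rho-L′ lam-k₀) (cancel (N L) (M k₀) (+ m) (+ toℕ k₀))
      where
      cancel : ∀ y x m k → (y - (+ 1 + m) + + 1 + k) + (x - (+ 1 + k) + (+ 1 + m)) ≡ y + x
      cancel = solve-∀
    rho≤N : rho* M N L ≤ N L
    rho≤N = ≤-rebalance (+≤+ (FinP.toℕ<n k₀))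
      (trans (cong (λ r → r + + suc m) rho-L′) (rebalance (N L) (+ m) (+ toℕ k₀)))
      where
      rebalance : ∀ y m k → y - (+ 1 + m) + + 1 + k + (+ 1 + m) ≡ y + (+ 1 + k)
      rebalance = solve-∀
    M≤rho : M k₀ ≤ rho* M N L
    M≤rho = subst (M k₀ ≤_) (sym rho-L) (≤-rebalance (ak₀≤b L) (rebalance (M k₀) (b L) (+ toℕ k₀)))
      where
      rebalance : ∀ x b k → x + b ≡ b + + 1 + k + (x - (+ 1 + k))
      rebalance = solve-∀

starExcess≤ : ∀ {n} {M N : Vector ℤ n} → Decreasing M → Decreasing N → ∀ t → StarExcess≤ t M N
starExcess≤ {zero} _ _ t = ℤP.≤-refl
starExcess≤ {suc m} {M} {N} decM decN t with count (λ j → shift M (fromℕ m) ℤ.≤? shift N j) ℕ.<? suc m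
... | yes j₀<n = starExcess-removeAt t M N L j₀ lam*-removeAt rho*-removeAt (excess-pair t)
  (starExcess≤ (Decreasing-removeAt L decM) (Decreasing-removeAt j₀ decN) t)
  where open RemoveLastOfM decM decN j₀<n
... | no j₀≮n with count (λ k → shift N (fromℕ m) ℤ.<? shift M k) ℕ.<? suc m
...   | yes k₀<n = starExcess-removeAt t M N k₀ L lam*-removeAt rho*-removeAt (excess-pair t)
  (starExcess≤ (Decreasing-removeAt k₀ decM) (Decreasing-removeAt L decN) t)
  where open RemoveLastOfN decM decN k₀<n
...   | no k₀≮n = ⊥-elim (ℤP.<⇒≱ shiftN<shiftM shiftM≤shiftN)
  where
  L = fromℕ m
  L<count : ∀ {c} → ¬ c ℕ.< suc m → toℕ L ℕ.< c
  L<count c≮n = subst (ℕ._< _) (sym (FinP.toℕ-fromℕ m)) (ℕP.≮⇒≥ c≮n)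
  shiftM≤shiftN : shift M L ≤ shift N L
  shiftM≤shiftN = Equivalence.from (≤shift⇔<count decN (shift M L) L) (L<count j₀≮n)
  shiftN<shiftM : shift N L < shift M L
  shiftN<shiftM = Equivalence.from (<shift⇔<count decM (shift N L) L) (L<count k₀≮n)


-- Partial sums of λ + ρ

prefixSum : ∀ {n} → ℕ → Vector ℕ n → ℕ
prefixSum zero g = 0
prefixSum {zero} (suc K) g = 0
prefixSum {suc n} (suc K) g = g fz ℕ.+ prefixSum K (g ∘ fs)

prefixSum-cong : ∀ {n} K {g h : Vector ℕ n} → (∀ i → g i ≡ h i) → prefixSum K g ≡ prefixSum K h
prefixSum-cong zero g≗h = refl
prefixSum-cong {zero} (suc K) g≗h = refl
prefixSum-cong {suc n} (suc K) g≗h = cong₂ ℕ._+_ (g≗h fz) (prefixSum-cong K (g≗h ∘ fs))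

prefixSum-+ : ∀ {n} K (g h : Vector ℕ n) →
  prefixSum K (λ i → g i ℕ.+ h i) ≡ prefixSum K g ℕ.+ prefixSum K h
prefixSum-+ zero g h = refl
prefixSum-+ {zero} (suc K) g h = refl
prefixSum-+ {suc n} (suc K) g h = trans (cong (g fz ℕ.+ h fz ℕ.+_) (prefixSum-+ K (g ∘ fs) (h ∘ fs)))
  (ℕ+-interchange (g fz) (h fz) (prefixSum K (g ∘ fs)) (prefixSum K (h ∘ fs)))

prefixSum≤sum : ∀ {n} K (g : Vector ℕ n) → prefixSum K g ℕ.≤ ℕΣ.sum g
prefixSum≤sum zero g = z≤n
prefixSum≤sum {zero} (suc K) g = z≤n
prefixSum≤sum {suc n} (suc K) g = ℕP.+-monoʳ-≤ (g fz) (prefixSum≤sum K (g ∘ fs))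

prefixSum-sum : ∀ {n} K (g : Vector ℕ n) → n ℕ.≤ K → prefixSum K g ≡ ℕΣ.sum g
prefixSum-sum zero g z≤n = refl
prefixSum-sum {zero} (suc K) g _ = refl
prefixSum-sum {suc n} (suc K) g (s≤s n≤K) = cong (g fz ℕ.+_) (prefixSum-sum K (g ∘ fs) n≤K)

module _ {m} {P Q : Fin m → Set} (P? : ∀ i → Dec (P i)) (Q? : ∀ i → Dec (Q i))
         (complement : ∀ i → 𝟙 (P? i) ℕ.+ 𝟙 (Q? i) ≡ 1) (K : ℕ) where

  private
    prefix-complement : prefixSum K (𝟙 ∘ P?) ℕ.+ prefixSum K (𝟙 ∘ Q?) ≡ prefixSum K (λ (_ : Fin m) → 1)
    prefix-complement = trans (sym (prefixSum-+ K (𝟙 ∘ P?) (𝟙 ∘ Q?))) (prefixSum-cong K complement)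

  count+prefixSum-≥ : prefixSum K (λ (_ : Fin m) → 1) ℕ.≤ count P? ℕ.+ prefixSum K (𝟙 ∘ Q?)
  count+prefixSum-≥ = subst (ℕ._≤ count P? ℕ.+ prefixSum K (𝟙 ∘ Q?)) prefix-complement
    (ℕP.+-monoˡ-≤ (prefixSum K (𝟙 ∘ Q?)) (prefixSum≤sum K (𝟙 ∘ P?)))

  count+prefixSum-≡ : m ℕ.≤ K → count P? ℕ.+ prefixSum K (𝟙 ∘ Q?) ≡ prefixSum K (λ (_ : Fin m) → 1)
  count+prefixSum-≡ m≤K =
    trans (cong (ℕ._+ prefixSum K (𝟙 ∘ Q?)) (sym (prefixSum-sum K (𝟙 ∘ P?) m≤K))) prefix-complement

prefixSum-odd-suc : ∀ {m} K → let k = prefixSum K (λ (_ : Fin m) → 1) in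
  prefixSum (suc K) (odd {suc m}) ≡ 1 ℕ.+ (k ℕ.+ k) ℕ.+ prefixSum K (odd {m})
prefixSum-odd-suc {m} K = begin
  1 ℕ.+ prefixSum K (odd ∘ fs)
    ≡⟨ cong (1 ℕ.+_) (prefixSum-cong K (λ i → shiftOdd (toℕ i))) ⟩
  1 ℕ.+ prefixSum K (λ i → odd i ℕ.+ (1 ℕ.+ 1))
    ≡⟨ cong (1 ℕ.+_) (prefixSum-+ K odd (λ _ → 1 ℕ.+ 1)) ⟩
  1 ℕ.+ (prefixSum K odd ℕ.+ prefixSum K (λ _ → 1 ℕ.+ 1))
    ≡⟨ cong (λ s → 1 ℕ.+ (prefixSum K odd ℕ.+ s)) (prefixSum-+ K (λ _ → 1) (λ _ → 1)) ⟩
  1 ℕ.+ (prefixSum K odd ℕ.+ (k ℕ.+ k))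
    ≡⟨ regroup (prefixSum K odd) k ⟩
  1 ℕ.+ (k ℕ.+ k) ℕ.+ prefixSum K odd ∎
  where
  open ≡-Reasoning
  k = prefixSum K (λ (_ : Fin m) → 1)
  shiftOdd : ∀ t → suc t ℕ.+ suc t ℕ.+ 1 ≡ (t ℕ.+ t ℕ.+ 1) ℕ.+ (1 ℕ.+ 1)
  shiftOdd = ℕsolve
  regroup : ∀ s k → 1 ℕ.+ (s ℕ.+ (k ℕ.+ k)) ≡ 1 ℕ.+ (k ℕ.+ k) ℕ.+ s
  regroup = ℕsolve

-- Peeling off index 0: the pair (0,0) contributes exactly 1, and the pairs (0,i), (i,0) with
-- 1 ≤ i ≤ K together at least 2 min(K, m), with equality when m ≤ K.
module _ {m} (K : ℕ) (a b : Vector ℤ (suc m)) where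

  private
    a₀ b₀ : ℤ
    a₀ = a fz
    b₀ = b fz
    a⁺ b⁺ : Vector ℤ m
    a⁺ = a ∘ fs
    b⁺ = b ∘ fs
    [a≤b₀] [b<a₀] : Vector ℕ m
    [a≤b₀] i = 𝟙 (a⁺ i ℤ.≤? b₀)
    [b<a₀] i = 𝟙 (b⁺ i ℤ.<? a₀)

  rowCount colCount : ℕ
  rowCount = count (λ j → a₀ ℤ.≤? b⁺ j) ℕ.+ prefixSum K [b<a₀]
  colCount = count (λ k → b₀ ℤ.<? a⁺ k) ℕ.+ prefixSum K [a≤b₀]

  prefixSum-crossCount-suc :
    prefixSum (suc K) (crossCount a b) ≡ 1 ℕ.+ (rowCount ℕ.+ colCount) ℕ.+ prefixSum K (crossCount a⁺ b⁺)
  prefixSum-crossCount-suc = begin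
    crossCount a b fz ℕ.+ prefixSum K (crossCount a b ∘ fs)
      ≡⟨ cong (crossCount a b fz ℕ.+_) (prefixSum-cong K split) ⟩
    crossCount a b fz ℕ.+ prefixSum K (λ i → ([a≤b₀] i ℕ.+ [b<a₀] i) ℕ.+ crossCount a⁺ b⁺ i)
      ≡⟨ cong (crossCount a b fz ℕ.+_)
           (trans (prefixSum-+ K (λ i → [a≤b₀] i ℕ.+ [b<a₀] i) (crossCount a⁺ b⁺))
                  (cong (ℕ._+ T) (prefixSum-+ K [a≤b₀] [b<a₀]))) ⟩
    (e₁ ℕ.+ r) ℕ.+ (e₂ ℕ.+ c) ℕ.+ (prefixSum K [a≤b₀] ℕ.+ prefixSum K [b<a₀] ℕ.+ T)
      ≡⟨ regroup e₁ r e₂ c (prefixSum K [a≤b₀]) (prefixSum K [b<a₀]) T ⟩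
    (e₁ ℕ.+ e₂) ℕ.+ (rowCount ℕ.+ colCount) ℕ.+ T
      ≡⟨ cong (λ e → e ℕ.+ (rowCount ℕ.+ colCount) ℕ.+ T) (𝟙-≤-< a₀ b₀) ⟩
    1 ℕ.+ (rowCount ℕ.+ colCount) ℕ.+ T ∎
    where
    open ≡-Reasoning
    e₁ = 𝟙 (a₀ ℤ.≤? b₀)
    e₂ = 𝟙 (b₀ ℤ.<? a₀)
    r = count (λ j → a₀ ℤ.≤? b⁺ j)
    c = count (λ k → b₀ ℤ.<? a⁺ k)
    T = prefixSum K (crossCount a⁺ b⁺)
    split : ∀ i → crossCount a b (fs i) ≡ ([a≤b₀] i ℕ.+ [b<a₀] i) ℕ.+ crossCount a⁺ b⁺ i
    split i = ℕ+-interchange ([a≤b₀] i) (count (λ j → a⁺ i ℤ.≤? b⁺ j))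
                             ([b<a₀] i) (count (λ k → b⁺ i ℤ.<? a⁺ k))
    regroup : ∀ e₁ r e₂ c p q T →
      (e₁ ℕ.+ r) ℕ.+ (e₂ ℕ.+ c) ℕ.+ (p ℕ.+ q ℕ.+ T)
        ≡ (e₁ ℕ.+ e₂) ℕ.+ ((r ℕ.+ q) ℕ.+ (c ℕ.+ p)) ℕ.+ T
    regroup = ℕsolve

  private
    complementʳ : ∀ i → 𝟙 (a₀ ℤ.≤? b⁺ i) ℕ.+ [b<a₀] i ≡ 1
    complementʳ i = 𝟙-≤-< a₀ (b⁺ i)
    complementᶜ : ∀ i → 𝟙 (b₀ ℤ.<? a⁺ i) ℕ.+ [a≤b₀] i ≡ 1
    complementᶜ i = trans (ℕP.+-comm (𝟙 (b₀ ℤ.<? a⁺ i)) ([a≤b₀] i)) (𝟙-≤-< (a⁺ i) b₀)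

  rowCount-≥ : prefixSum K (λ (_ : Fin m) → 1) ℕ.≤ rowCount
  rowCount-≥ = count+prefixSum-≥ (λ j → a₀ ℤ.≤? b⁺ j) (λ i → b⁺ i ℤ.<? a₀) complementʳ K

  colCount-≥ : prefixSum K (λ (_ : Fin m) → 1) ℕ.≤ colCount
  colCount-≥ = count+prefixSum-≥ (λ k → b₀ ℤ.<? a⁺ k) (λ i → a⁺ i ℤ.≤? b₀) complementᶜ K

  rowCount-≡ : m ℕ.≤ K → rowCount ≡ prefixSum K (λ (_ : Fin m) → 1)
  rowCount-≡ = count+prefixSum-≡ (λ j → a₀ ℤ.≤? b⁺ j) (λ i → b⁺ i ℤ.<? a₀) complementʳ K

  colCount-≡ : m ℕ.≤ K → colCount ≡ prefixSum K (λ (_ : Fin m) → 1)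
  colCount-≡ = count+prefixSum-≡ (λ k → b₀ ℤ.<? a⁺ k) (λ i → a⁺ i ℤ.≤? b₀) complementᶜ K

prefixSum-odd≤crossCount : ∀ {n} K (a b : Vector ℤ n) →
  prefixSum K (odd {n}) ℕ.≤ prefixSum K (crossCount a b)
prefixSum-odd≤crossCount zero a b = z≤n
prefixSum-odd≤crossCount {zero} (suc K) a b = z≤n
prefixSum-odd≤crossCount {suc m} (suc K) a b = begin
  prefixSum (suc K) (odd {suc m})
    ≡⟨ prefixSum-odd-suc {m} K ⟩
  1 ℕ.+ (k ℕ.+ k) ℕ.+ prefixSum K (odd {m})
    ≤⟨ ℕP.+-mono-≤ (ℕP.+-monoʳ-≤ 1 (ℕP.+-mono-≤ (rowCount-≥ K a b) (colCount-≥ K a b)))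
                   (prefixSum-odd≤crossCount {m} K (a ∘ fs) (b ∘ fs)) ⟩
  1 ℕ.+ (rowCount K a b ℕ.+ colCount K a b) ℕ.+ prefixSum K (crossCount (a ∘ fs) (b ∘ fs))
    ≡⟨ prefixSum-crossCount-suc K a b ⟨
  prefixSum (suc K) (crossCount a b) ∎
  where
  open ℕP.≤-Reasoning
  k = prefixSum K (λ (_ : Fin m) → 1)

prefixSum-odd≡crossCount : ∀ {n} K (a b : Vector ℤ n) → n ℕ.≤ K →
  prefixSum K (odd {n}) ≡ prefixSum K (crossCount a b)
prefixSum-odd≡crossCount zero a b z≤n = refl
prefixSum-odd≡crossCount {zero} (suc K) a b _ = refl
prefixSum-odd≡crossCount {suc m} (suc K) a b (s≤s m≤K) = begin
  prefixSum (suc K) (odd {suc m})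
    ≡⟨ prefixSum-odd-suc {m} K ⟩
  1 ℕ.+ (k ℕ.+ k) ℕ.+ prefixSum K (odd {m})
    ≡⟨ cong₂ (λ r s → 1 ℕ.+ r ℕ.+ s)
             (sym (cong₂ ℕ._+_ (rowCount-≡ K a b m≤K) (colCount-≡ K a b m≤K)))
             (prefixSum-odd≡crossCount {m} K (a ∘ fs) (b ∘ fs) m≤K) ⟩
  1 ℕ.+ (rowCount K a b ℕ.+ colCount K a b) ℕ.+ prefixSum K (crossCount (a ∘ fs) (b ∘ fs))
    ≡⟨ prefixSum-crossCount-suc K a b ⟨
  prefixSum (suc K) (crossCount a b) ∎
  where
  open ≡-Reasoning
  k = prefixSum K (λ (_ : Fin m) → 1)


-- Dominance of integer lists

insert-↭ : ∀ x ys → insert x ys ↭ x ∷ ys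
insert-↭ x [] = ↭-refl
insert-↭ x (y ∷ ys) with y ℤ.≤? x
... | yes _ = ↭-refl
... | no _ = ↭-trans (↭-prep y (insert-↭ x ys)) (↭-swap y x ↭-refl)

sortDesc-↭ : ∀ xs → sortDesc xs ↭ xs
sortDesc-↭ [] = ↭-refl
sortDesc-↭ (x ∷ xs) = ↭-trans (insert-↭ x (sortDesc xs)) (↭-prep x (sortDesc-↭ xs))

insert-sorted : ∀ x {ys} → AllPairs _≥_ ys → AllPairs _≥_ (insert x ys)
insert-sorted x [] = [] ∷ []
insert-sorted x {y ∷ ys} (y≥ys ∷ sorted) with y ℤ.≤? x
... | yes y≤x = (y≤x ∷ All.map (λ z≤y → ℤP.≤-trans z≤y y≤x) y≥ys) ∷ y≥ys ∷ sorted
... | no y≰x =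
  All-resp-↭ (↭-sym (insert-↭ x ys)) (ℤP.<⇒≤ (ℤP.≰⇒> y≰x) ∷ y≥ys) ∷ insert-sorted x sorted

sortDesc-sorted : ∀ xs → AllPairs _≥_ (sortDesc xs)
sortDesc-sorted [] = []
sortDesc-sorted (x ∷ xs) = insert-sorted x (sortDesc-sorted xs)

sumℤ-↭ : ∀ {xs ys} → xs ↭ ys → sumℤ xs ≡ sumℤ ys
sumℤ-↭ p = foldr-commMonoid (setoid ℤ) ℤP.+-0-isCommutativeMonoid (↭⇒↭ₛ p)

sumℤ-++ : ∀ xs ys → sumℤ (xs ++ ys) ≡ sumℤ xs + sumℤ ys
sumℤ-++ [] ys = sym (ℤP.+-identityˡ (sumℤ ys))
sumℤ-++ (x ∷ xs) ys = trans (cong (λ s → x + s) (sumℤ-++ xs ys)) (sym (ℤP.+-assoc x (sumℤ xs) (sumℤ ys)))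

sumℤ-tabulate : ∀ {n} (g : Vector ℤ n) → sumℤ (List.tabulate g) ≡ sum g
sumℤ-tabulate {zero} g = refl
sumℤ-tabulate {suc n} g = cong (λ s → g fz + s) (sumℤ-tabulate (g ∘ fs))

sumℤ-tabulate≡psum : ∀ {n} (g : Vector ℤ n) → sumℤ (List.tabulate g) ≡ psum n (List.tabulate g)
sumℤ-tabulate≡psum g =
  cong sumℤ (sym (LP.take-all _ (List.tabulate g) (ℕP.≤-reflexive (LP.length-tabulate g))))

excessSumᴸ : ℤ → List ℤ → ℤ
excessSumᴸ t xs = sumℤ (List.map (excess t) xs)

excessSumᴸ-↭ : ∀ t {xs ys} → xs ↭ ys → excessSumᴸ t xs ≡ excessSumᴸ t ys
excessSumᴸ-↭ t p = sumℤ-↭ (map⁺ (excess t) p)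

excessSumᴸ-nonneg : ∀ t xs → + 0 ≤ excessSumᴸ t xs
excessSumᴸ-nonneg t [] = ℤP.≤-refl
excessSumᴸ-nonneg t (x ∷ xs) = ℤP.+-mono-≤ (excess-nonneg t x) (excessSumᴸ-nonneg t xs)

excessSumᴸ-below : ∀ t {xs} → All (_≤ t) xs → excessSumᴸ t xs ≡ + 0
excessSumᴸ-below t [] = refl
excessSumᴸ-below t (x≤t ∷ xs≤t) = cong₂ _+_ (excess-below x≤t) (excessSumᴸ-below t xs≤t)

-- For every threshold t, each of the first K parts is at most t plus its excess over t.
psum≤excess : ∀ t K xs → K ℕ.≤ length xs → psum K xs ≤ K · t + excessSumᴸ t xs
psum≤excess t zero xs _ = subst (+ 0 ≤_) (sym (ℤP.+-identityˡ (excessSumᴸ t xs))) (excessSumᴸ-nonneg t xs)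
psum≤excess t (suc K) (x ∷ xs) (s≤s K≤n) = begin
  x + psum K xs                                   ≤⟨ ℤP.+-mono-≤ x≤t+excess (psum≤excess t K xs K≤n) ⟩
  (t + excess t x) + (K · t + excessSumᴸ t xs)    ≡⟨ +-interchange t (excess t x) (K · t) (excessSumᴸ t xs) ⟩
  (t + K · t) + (excess t x + excessSumᴸ t xs)    ∎
  where
  open ℤP.≤-Reasoning
  x≤t+excess : x ≤ t + excess t x
  x≤t+excess = ≤-rebalance (ℤP.i≤i⊔j (x - t) (+ 0)) (rebalance x t (excess t x))
    where
    rebalance : ∀ x t e → x + e ≡ t + e + (x - t)
    rebalance = solve-∀

-- ... with equality for a sorted list when t is its (K+1)-st part.
psum≡excess : ∀ K ys → AllPairs _≥_ ys → K ℕ.< length ys →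
  ∃[ t ] t ∈ ys × psum K ys ≡ K · t + excessSumᴸ t ys
psum≡excess zero (y ∷ ys) (y≥ys ∷ _) _ = y , here refl , sym (begin
  + 0 + (excess y y + excessSumᴸ y ys)  ≡⟨ ℤP.+-identityˡ _ ⟩
  excess y y + excessSumᴸ y ys          ≡⟨ cong₂ _+_ (excess-below {y} {y} ℤP.≤-refl) (excessSumᴸ-below y y≥ys) ⟩
  + 0                                   ∎)
  where open ≡-Reasoning
psum≡excess (suc K) (y ∷ ys) (y≥ys ∷ sorted) (s≤s K<n) with psum≡excess K ys sorted K<n
... | t , t∈ys , eq = t , there t∈ys , (begin
  y + psum K ys                                   ≡⟨ cong (λ s → y + s) eq ⟩
  y + (K · t + excessSumᴸ t ys)                   ≡⟨ regroup y t (K · t) (excessSumᴸ t ys) ⟩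
  (t + K · t) + ((y - t) + excessSumᴸ t ys)
    ≡⟨ cong (λ e → (t + K · t) + (e + excessSumᴸ t ys)) (excess-above (All.lookup y≥ys t∈ys)) ⟨
  (t + K · t) + (excess t y + excessSumᴸ t ys)    ∎)
  where
  open ≡-Reasoning
  regroup : ∀ y t Kt E → y + (Kt + E) ≡ (t + Kt) + ((y - t) + E)
  regroup = solve-∀

-- The threshold criterion for dominance (one direction of Hardy–Littlewood–Pólya).
sortDesc-⪯ : ∀ xs ys → length xs ≡ length ys → sumℤ xs ≡ sumℤ ys →
  (∀ t → excessSumᴸ t xs ≤ excessSumᴸ t ys) → sortDesc xs ⪯ sortDesc ys
sortDesc-⪯ xs ys length≡ sum≡ excess≤ = sum-sorted≡ , psum≤
  where
  xs' = sortDesc xs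
  ys' = sortDesc ys
  sum-sorted≡ : sumℤ xs' ≡ sumℤ ys'
  sum-sorted≡ = trans (sumℤ-↭ (sortDesc-↭ xs)) (trans sum≡ (sym (sumℤ-↭ (sortDesc-↭ ys))))
  length-sorted≡ : length xs' ≡ length ys'
  length-sorted≡ = trans (↭-length (sortDesc-↭ xs)) (trans length≡ (sym (↭-length (sortDesc-↭ ys))))
  psum≤ : ∀ K → psum K xs' ≤ psum K ys'
  psum≤ K with K ℕ.<? length ys'
  ... | yes K<n with psum≡excess K ys' (sortDesc-sorted ys) K<n
  ...   | t , _ , eq = begin
    psum K xs'                   ≤⟨ psum≤excess t K xs' K≤length ⟩
    K · t + excessSumᴸ t xs'     ≡⟨ cong (λ e → K · t + e) (excessSumᴸ-↭ t (sortDesc-↭ xs)) ⟩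
    K · t + excessSumᴸ t xs      ≤⟨ ℤP.+-monoʳ-≤ (K · t) (excess≤ t) ⟩
    K · t + excessSumᴸ t ys      ≡⟨ cong (λ e → K · t + e) (excessSumᴸ-↭ t (sortDesc-↭ ys)) ⟨
    K · t + excessSumᴸ t ys'     ≡⟨ eq ⟨
    psum K ys'                   ∎
    where
    open ℤP.≤-Reasoning
    K≤length = subst (K ℕ.≤_) (sym length-sorted≡) (ℕP.<⇒≤ K<n)
  psum≤ K | no K≮n = ℤP.≤-reflexive (begin
    sumℤ (List.take K xs')       ≡⟨ cong sumℤ (LP.take-all K xs' (subst (ℕ._≤ K) (sym length-sorted≡) n≤K)) ⟩
    sumℤ xs'                     ≡⟨ sum-sorted≡ ⟩
    sumℤ ys'                     ≡⟨ cong sumℤ (LP.take-all K ys' n≤K) ⟨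
    sumℤ (List.take K ys')       ∎)
    where
    open ≡-Reasoning
    n≤K = ℕP.≮⇒≥ K≮n

psum-tabulate-+ : ∀ {n} K (g : Vector ℤ n) (c o : Vector ℕ n) →
  psum K (List.tabulate (λ i → g i + (+ c i - + o i)))
    ≡ psum K (List.tabulate g) + (+ prefixSum K c - + prefixSum K o)
psum-tabulate-+ zero g c o = refl
psum-tabulate-+ {zero} (suc K) g c o = refl
psum-tabulate-+ {suc n} (suc K) g c o = begin
  g fz + d₀ + psum K (List.tabulate (λ i → g (fs i) + (+ c (fs i) - + o (fs i))))
    ≡⟨ cong (λ s → g fz + d₀ + s) (psum-tabulate-+ K (g ∘ fs) (c ∘ fs) (o ∘ fs)) ⟩
  g fz + d₀ + (G + (+ C - + O))                   ≡⟨ regroup (g fz) (+ c fz) (+ o fz) G (+ C) (+ O) ⟩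
  g fz + G + ((+ c fz + + C) - (+ o fz + + O))   ∎
  where
  open ≡-Reasoning
  d₀ = + c fz - + o fz
  G = psum K (List.tabulate (g ∘ fs))
  C = prefixSum K (c ∘ fs)
  O = prefixSum K (o ∘ fs)
  regroup : ∀ x c o X C O → x + (c - o) + (X + (C - O)) ≡ x + X + ((c + C) - (o + O))
  regroup = solve-∀

tabulate-⪯-+ : ∀ {n} (g : Vector ℤ n) (c o : Vector ℕ n) →
  (∀ K → prefixSum K o ℕ.≤ prefixSum K c) → prefixSum n o ≡ prefixSum n c →
  List.tabulate g ⪯ List.tabulate (λ i → g i + (+ c i - + o i))
tabulate-⪯-+ {n} g c o o≤c o≡c = sum≡ , psum≤
  where
  h : Vector ℤ n
  h i = g i + (+ c i - + o i)
  psum≤ : ∀ K → psum K (List.tabulate g) ≤ psum K (List.tabulate h)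
  psum≤ K = begin
    psum K (List.tabulate g)                                         ≡⟨ ℤP.+-identityʳ _ ⟨
    psum K (List.tabulate g) + + 0
      ≤⟨ ℤP.+-monoʳ-≤ (psum K (List.tabulate g)) (ℤP.i≤j⇒0≤j-i (+≤+ (o≤c K))) ⟩
    psum K (List.tabulate g) + (+ prefixSum K c - + prefixSum K o)   ≡⟨ psum-tabulate-+ K g c o ⟨
    psum K (List.tabulate h)                                         ∎
    where open ℤP.≤-Reasoning
  sum≡ : sumℤ (List.tabulate g) ≡ sumℤ (List.tabulate h)
  sum≡ = begin
    sumℤ (List.tabulate g)                                           ≡⟨ sumℤ-tabulate≡psum g ⟩
    psum n (List.tabulate g)                                         ≡⟨ ℤP.+-identityʳ _ ⟨
    psum n (List.tabulate g) + + 0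
      ≡⟨ cong (λ d → psum n (List.tabulate g) + d) no-correction ⟨
    psum n (List.tabulate g) + (+ prefixSum n c - + prefixSum n o)   ≡⟨ psum-tabulate-+ n g c o ⟨
    psum n (List.tabulate h)                                         ≡⟨ sumℤ-tabulate≡psum h ⟨
    sumℤ (List.tabulate h)                                           ∎
    where
    open ≡-Reasoning
    no-correction : + prefixSum n c - + prefixSum n o ≡ + 0
    no-correction = ℤP.i≡j⇒i-j≡0 (cong (λ k → + k) (sym o≡c))

tabulate-+-⪯ : ∀ {n} (M N : Vector ℤ n) →
  List.tabulate (λ i → M i + N i) ⪯ List.tabulate (λ i → lam* M N i + rho* M N i)
tabulate-+-⪯ {n} M N = subst (List.tabulate (λ i → M i + N i) ⪯_) (LP.tabulate-cong (sym ∘ lam*+rho* M N))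
  (tabulate-⪯-+ (λ i → M i + N i) (crossCount (shift M) (shift N)) odd
    (λ K → prefixSum-odd≤crossCount K (shift M) (shift N))
    (prefixSum-odd≡crossCount n (shift M) (shift N) ℕP.≤-refl))

sumℤ-tabulate-++ : ∀ {n} (g h : Vector ℤ n) →
  sumℤ (List.tabulate g ++ List.tabulate h) ≡ sumℤ (List.tabulate (λ i → g i + h i))
sumℤ-tabulate-++ g h = begin
  sumℤ (List.tabulate g ++ List.tabulate h)          ≡⟨ sumℤ-++ (List.tabulate g) (List.tabulate h) ⟩
  sumℤ (List.tabulate g) + sumℤ (List.tabulate h)    ≡⟨ cong₂ _+_ (sumℤ-tabulate g) (sumℤ-tabulate h) ⟩
  sum g + sum h                                      ≡⟨ ∑-distrib-+ g h ⟨
  sum (λ i → g i + h i)                              ≡⟨ sumℤ-tabulate (λ i → g i + h i) ⟨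
  sumℤ (List.tabulate (λ i → g i + h i))             ∎
  where open ≡-Reasoning

excessSumᴸ-tabulate-++ : ∀ t {n} (g h : Vector ℤ n) →
  excessSumᴸ t (List.tabulate g ++ List.tabulate h) ≡ excessSum t g + excessSum t h
excessSumᴸ-tabulate-++ t g h = begin
  sumℤ (List.map (excess t) (List.tabulate g ++ List.tabulate h))
    ≡⟨ cong sumℤ (LP.map-++ (excess t) (List.tabulate g) (List.tabulate h)) ⟩
  sumℤ (List.map (excess t) (List.tabulate g) ++ List.map (excess t) (List.tabulate h))
    ≡⟨ sumℤ-++ (List.map (excess t) (List.tabulate g)) _ ⟩
  excessSumᴸ t (List.tabulate g) + excessSumᴸ t (List.tabulate h)
    ≡⟨ cong₂ _+_ (excessSumᴸ-tabulate g) (excessSumᴸ-tabulate h) ⟩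
  excessSum t g + excessSum t h ∎
  where
  open ≡-Reasoning
  excessSumᴸ-tabulate : ∀ {n} (f : Vector ℤ n) → excessSumᴸ t (List.tabulate f) ≡ excessSum t f
  excessSumᴸ-tabulate f = trans (cong sumℤ (LP.map-tabulate f (excess t))) (sumℤ-tabulate (excess t ∘ f))

tabulate-∪-⪯ : ∀ {n} {M N : Vector ℤ n} → Decreasing M → Decreasing N →
  sortDesc (List.tabulate (lam* M N) ++ List.tabulate (rho* M N)) ⪯ sortDesc (List.tabulate M ++ List.tabulate N)
tabulate-∪-⪯ {n} {M} {N} decM decN = sortDesc-⪯ λρ μν length≡ sum≡ excess≤
  where
  λρ μν : List ℤ
  λρ = List.tabulate (lam* M N) ++ List.tabulate (rho* M N)
  μν = List.tabulate M ++ List.tabulate N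
  length≡ : length λρ ≡ length μν
  length≡ = trans (LP.length-++ (List.tabulate (lam* M N)))
    (trans (cong₂ ℕ._+_ (LP.length-tabulate (lam* M N)) (LP.length-tabulate (rho* M N)))
      (sym (trans (LP.length-++ (List.tabulate M)) (cong₂ ℕ._+_ (LP.length-tabulate M) (LP.length-tabulate N)))))
  sum≡ : sumℤ λρ ≡ sumℤ μν
  sum≡ = trans (sumℤ-tabulate-++ (lam* M N) (rho* M N))
    (trans (sym (proj₁ (tabulate-+-⪯ M N))) (sym (sumℤ-tabulate-++ M N)))
  excess≤ : ∀ t → excessSumᴸ t λρ ≤ excessSumᴸ t μν
  excess≤ t = subst₂ _≤_ (sym (excessSumᴸ-tabulate-++ t (lam* M N) (rho* M N)))
    (sym (excessSumᴸ-tabulate-++ t M N)) (starExcess≤ decM decN t)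


toList-tabulate : ∀ {n} {A : Set} (f : Fin n → A) → toList (Vec.tabulate f) ≡ List.tabulate f
toList-tabulate {zero} f = refl
toList-tabulate {suc n} f = cong (f fz ∷_) (toList-tabulate (f ∘ fs))

length-filter-tabulate : ∀ {n} {A : Set} {P : A → Set} (P? : ∀ x → Dec (P x)) (g : Fin n → A) →
  length (List.filter P? (List.tabulate g)) ≡ count (P? ∘ g)
length-filter-tabulate {zero} P? g = refl
length-filter-tabulate {suc n} P? g with P? (g fz)
... | yes _ = cong suc (length-filter-tabulate P? (g ∘ fs))
... | no _ = length-filter-tabulate P? (g ∘ fs)

zipWith-tabulate : ∀ {n} (f : ℤ → ℤ → ℤ) (g h : Fin n → ℤ) →
  List.zipWith f (List.tabulate g) (List.tabulate h) ≡ List.tabulate (λ i → f (g i) (h i))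
zipWith-tabulate {zero} f g h = refl
zipWith-tabulate {suc n} f g h = cong (f (g fz) (h fz) ∷_) (zipWith-tabulate f (g ∘ fs) (h ∘ fs))

asℤ : ∀ {n} → Vec ℕ n → Vector ℤ n
asℤ v i = + lookup v i

toℤs-tabulate : ∀ {n} (v : Vec ℕ n) → toℤs v ≡ List.tabulate (asℤ v)
toℤs-tabulate v = begin
  List.map (λ k → + k) (toList v)
    ≡⟨ cong (λ w → List.map (λ k → + k) (toList w)) (VP.tabulate∘lookup v) ⟨
  List.map (λ k → + k) (toList (Vec.tabulate (lookup v)))
    ≡⟨ cong (List.map (λ k → + k)) (toList-tabulate (lookup v)) ⟩
  List.map (λ k → + k) (List.tabulate (lookup v))
    ≡⟨ LP.map-tabulate (lookup v) (λ k → + k) ⟩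
  List.tabulate (asℤ v) ∎
  where open ≡-Reasoning

module _ {n} (μ ν : Vec ℕ n) where

  starλ-tabulate : toList (starλ μ ν) ≡ List.tabulate (lam* (asℤ μ) (asℤ ν))
  starλ-tabulate = trans (toList-tabulate _)
    (LP.tabulate-cong λ k → cong (λ c → shifted μ k + + c)
      (length-filter-tabulate (λ j → shifted μ k ℤ.≤? shifted ν j) id))

  starρ-tabulate : toList (starρ μ ν) ≡ List.tabulate (rho* (asℤ μ) (asℤ ν))
  starρ-tabulate = trans (toList-tabulate _)
    (LP.tabulate-cong λ j → cong (λ c → shifted ν j + + 1 + + c)
      (length-filter-tabulate (λ k → shifted ν j ℤ.<? shifted μ k) id))

lemma2p4 : (n : ℕ) (μ ν : Vec ℕ n) → IsPartition μ → IsPartition ν →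
    ((toList (starλ μ ν) ∪ₚ toList (starρ μ ν)) ⪯ (toℤs μ ∪ₚ toℤs ν))
    × ((toℤs μ +ₚ toℤs ν) ⪯ (toList (starλ μ ν) +ₚ toList (starρ μ ν)))
lemma2p4 n μ ν μ-partition ν-partition
  rewrite starλ-tabulate μ ν | starρ-tabulate μ ν | toℤs-tabulate μ | toℤs-tabulate ν
        | zipWith-tabulate _+_ (asℤ μ) (asℤ ν)
        | zipWith-tabulate _+_ (lam* (asℤ μ) (asℤ ν)) (rho* (asℤ μ) (asℤ ν))
  = tabulate-∪-⪯ (λ le → +≤+ (μ-partition _ _ le)) (λ le → +≤+ (ν-partition _ _ le))
  , tabulate-+-⪯ (asℤ μ) (asℤ ν)
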